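{- Let $n\ge 1$, and regard $C_n(q)$ as a polynomial in an indeterminate $q$. Then \[ \frac{C_n(q)}{q^n} = \sum (-1)^h \left( q^a + q^{ -a} \right), \] where the sum is over all pairs $(h,a)$ with $h$ a positive integer and $a\in \mathbb{Z}$ such that $n=h(h+1+2a)/2$. Moreover, if $n$ has such a representation and $|a|$ is given, then $a$ and $h$ are uniquely determined.
   Context: For a prime power $q$, $C_n(q)$ denotes the number of ideals $I$ of $\mathbb{F}_q[x,y,x^{ -1},y^{ -1}]$ with $\dim_{\mathbb{F}_q}$ of the quotient equal to $n$; it is known that this is given by a polynomial in $q$ of degree $2n$ with integer coefficients (and this polynomial is what is meant). It is also known that $C_n(q)/q^n = c_{n,0}+\sum_{i=1}^n c_{n,i}(q^i+q^{ -i})$, where $c_{n,0}=2(-1)^r$ if $n=r(r+1)/2$ for some positive integer $r$ and $c_{n,0}=0$ otherwise, and for $i\ge 1$, $c_{n,i}=(-1)^k$ if $n=k(k+2i+1)/2$ for some integer $k\ge1$, $c_{n,i}=(-1)^{k-1}$ if $n=k(k+2i-1)/2$ for some integer $k\ge 1$, and $c_{n,i}=0$ otherwise. -}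

module Defs where

open import Data.Nat as ℕ using (ℕ; zero; suc; _≡ᵇ_)
open import Data.Integer as ℤ using (ℤ; +_; -[1+_])
open import Data.Maybe using (Maybe; just; nothing)
open import Data.Bool using (Bool; true; false; if_then_else_)
open import Data.List using (List; []; _∷_)
open import Data.Product using (_×_; _,_)
open import Relation.Nullary.Decidable using (⌊_⌋)

sgn : ℕ → ℤ
sgn zero    = + 1
sgn (suc k) = ℤ.- sgn k

search : (ℕ → Bool) → ℕ → Maybe ℕ
search P zero = nothing
search P (suc b) with search P b
... | just k  = just k
... | nothing = if P (suc b) then just (suc b) else nothing

-- c_{n,0} : 2(-1)^r if n = r(r+1)/2 for some positive integer r, else 0.
-- (r ≤ r(r+1) = 2n, so searching r ∈ {1,…,2n} is exhaustive.)
c₀ : ℕ → ℤ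
c₀ n with search (λ r → (2 ℕ.* n) ≡ᵇ (r ℕ.* (r ℕ.+ 1))) (2 ℕ.* n)
... | just r  = + 2 ℤ.* sgn r
... | nothing = + 0

-- c_{n,i} for i ≥ 1 (argument i given as i = suc m):
--   (-1)^k      if n = k(k+2i+1)/2 for some integer k ≥ 1,
--   (-1)^(k-1)  if n = k(k+2i-1)/2 for some integer k ≥ 1,
--   0           otherwise.
-- (k ≤ 2n in each case, so searching k ∈ {1,…,2n} is exhaustive.)
cᵢ : ℕ → ℕ → ℤ
cᵢ n i with search (λ k → (2 ℕ.* n) ≡ᵇ (k ℕ.* (k ℕ.+ 2 ℕ.* i ℕ.+ 1))) (2 ℕ.* n)
... | just k  = sgn k
... | nothing with search (λ k → (2 ℕ.* n) ≡ᵇ (k ℕ.* (k ℕ.+ 2 ℕ.* i ℕ.∸ 1))) (2 ℕ.* n)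
...   | just k  = sgn (k ℕ.∸ 1)
...   | nothing = + 0

-- Coefficient of q^j in the Laurent polynomial C_n(q)/q^n
--   = c_{n,0} + Σ_{i=1}^n c_{n,i} (q^i + q^{-i})   (the known formula from the context).
-- For |j| > n this is 0, since no k ≥ 1 satisfies k(k+2|j|-1) = 2n then.
CnOverQnCoeff : ℕ → ℤ → ℤ
CnOverQnCoeff n (+ zero)    = c₀ n
CnOverQnCoeff n (+ (suc m)) = cᵢ n (suc m)
CnOverQnCoeff n -[1+ m ]    = cᵢ n (suc m)

[_≟_] : ℤ → ℤ → ℤ
[ a ≟ j ] = if ⌊ a ℤ.≟ j ⌋ then + 1 else + 0

-- Coefficient of q^j in  Σ_{(h,a) ∈ L} (-1)^h (q^a + q^{-a})
sumCoeff : List (ℕ × ℤ) → ℤ → ℤ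
sumCoeff []            j = + 0
sumCoeff ((h , a) ∷ L) j = sgn h ℤ.* ([ a ≟ j ] ℤ.+ [ ℤ.- a ≟ j ]) ℤ.+ sumCoeff L j

-- Write a = m or a = -(m + 1) with m ≥ 0. Then 2n = h (h + 1 + 2a) reads 2n = h (h + 2m + 1),
-- respectively 2n = k (k + 2m + 1) with k = h - 2m - 1 ≥ 1 and (-1)^h = (-1)^(k-1): exactly the
-- two conditions defining c_{n,m} and c_{n,m+1}. As x ↦ x (x + c) is strictly increasing, a
-- determines h; and a = m + 1, a = -(m + 1) cannot both occur, since x (x + c + 2) lies strictly
-- between x (x + c) and (x + 1)(x + 1 + c). So the coefficient of q^a in the sum is the sign of
-- the unique representation with that a, if any, which is what the searches defining c_{n,i} find.

module Submission where

open import Defs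
open import Data.Bool using (T; true; false; if_then_else_)
open import Data.Empty using (⊥-elim)
open import Data.Integer as ℤ using (ℤ; +_; -[1+_]; ∣_∣)
import Data.Integer.Properties as ℤP
import Data.Integer.Tactic.RingSolver as ℤSolver
open import Data.List using (List; []; _∷_; map; _++_; upTo; filter; cartesianProduct)
open import Data.List.Membership.Propositional using (_∈_)
open import Data.List.Membership.Propositional.Properties
  using (∈-map⁺; ∈-map⁻; ∈-++⁺ˡ; ∈-++⁺ʳ; ∈-upTo⁺; ∈-filter⁺; ∈-filter⁻; ∈-cartesianProduct⁺)
open import Data.List.Relation.Binary.Disjoint.Propositional using (Disjoint)
open import Data.List.Relation.Unary.All as All using ()
open import Data.List.Relation.Unary.AllPairs using (_∷_)
open import Data.List.Relation.Unary.Any using (here; there)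
open import Data.List.Relation.Unary.Unique.Propositional using (Unique)
open import Data.List.Relation.Unary.Unique.Propositional.Properties
  using (map⁺; ++⁺; upTo⁺; filter⁺; cartesianProduct⁺)
open import Data.Maybe using (just; nothing)
open import Data.Nat as ℕ using (ℕ; zero; suc; _+_; _*_; _∸_; _≡ᵇ_; _≤_; _<_; z≤n; s≤s)
open import Data.Nat.Properties hiding (_≟_)
open import Data.Nat.Tactic.RingSolver using (solve-∀)
open import Data.Product using (Σ; ∃-syntax; _×_; _,_; proj₁; proj₂; uncurry)
open import Data.Sum using (inj₁; inj₂)
open import Function using (_∘′_)
open import Function.Bundles using (_⇔_; mk⇔; Equivalence)
open import Function.Construct.Composition using (_⇔-∘_)
open import Relation.Binary using (tri<; tri≈; tri>)
open import Relation.Binary.PropositionalEquality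
  using (_≡_; _≢_; refl; sym; trans; cong; cong₂; subst; module ≡-Reasoning)
open import Relation.Nullary using (¬_; yes; no; _×-dec_)
open import Relation.Nullary.Decidable using (map′; does-⇔; isYes≗does)
open import Relation.Unary using (Decidable)

oblong : ℕ → ℕ → ℕ
oblong c x = x * (x + c)

oblong-mono-≤ : ∀ c {x y} → x ≤ y → oblong c x ≤ oblong c y
oblong-mono-≤ c x≤y = *-mono-≤ x≤y (+-monoˡ-≤ c x≤y)

oblong-strictMono : ∀ c {x y} → x < y → oblong c x < oblong c y
oblong-strictMono c {x} {suc y} x<y =
  ≤-<-trans (*-monoʳ-≤ x (+-monoˡ-≤ c (<⇒≤ x<y))) (*-monoˡ-< (suc y + c) x<y)

oblong-injective : ∀ c {x y} → oblong c x ≡ oblong c y → x ≡ y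
oblong-injective c {x} {y} e with <-cmp x y
... | tri< x<y _ _ = ⊥-elim (<-irrefl e (oblong-strictMono c x<y))
... | tri≈ _ x≡y _ = x≡y
... | tri> _ _ y<x = ⊥-elim (<-irrefl (sym e) (oblong-strictMono c y<x))

oblong-≥ : ∀ c {x} → 1 ≤ x → x + c ≤ oblong c x
oblong-≥ c {suc x} _ = m≤n*m (suc x + c) (suc x)

oblong-suc : ∀ c x → oblong c (suc x) ≡ oblong (2 + c) x + suc c
oblong-suc c x = expand c x
  where
  expand : ∀ c x → suc x * (suc x + c) ≡ x * (x + (2 + c)) + suc c
  expand = solve-∀

-- oblong (2 + c) (x + 1) lies strictly between oblong c (x + 1) and oblong c (x + 2).
oblong-+2-≢ : ∀ c x y → oblong (2 + c) (suc x) ≢ oblong c y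
oblong-+2-≢ c x y e with ≤-<-connex y (suc x)
... | inj₁ y≤x = <-irrefl (sym e) (begin-strict
  oblong c y             ≤⟨ oblong-mono-≤ c y≤x ⟩
  oblong c (suc x)       <⟨ *-monoʳ-< (suc x) (+-monoʳ-< (suc x) (m<n+m c (s≤s z≤n))) ⟩
  oblong (2 + c) (suc x) ∎)
  where open ≤-Reasoning
... | inj₂ x<y = <-irrefl e (begin-strict
  oblong (2 + c) (suc x)         <⟨ m<m+n _ (s≤s z≤n) ⟩
  oblong (2 + c) (suc x) + suc c ≡⟨ oblong-suc c (suc x) ⟨
  oblong c (suc (suc x))         ≤⟨ oblong-mono-≤ c x<y ⟩
  oblong c y                     ∎)
  where open ≤-Reasoning

search-just : ∀ P b {k} → search P b ≡ just k → 1 ≤ k × k ≤ b × T (P k)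
search-just P zero    ()
search-just P (suc b) found with search P b in found′
... | just _ with refl ← found = let k≥1 , k≤b , t = search-just P b found′ in k≥1 , m≤n⇒m≤1+n k≤b , t
... | nothing with P (suc b) in holds
...   | true with refl ← found = s≤s z≤n , ≤-refl , subst T (sym holds) _
...   | false with () ← found

search-nothing : ∀ P b {k} → search P b ≡ nothing → 1 ≤ k → k ≤ b → ¬ T (P k)
search-nothing P zero    _     (s≤s _) ()
search-nothing P (suc b) found k≥1 k≤b t with search P b in found′
... | just _ with () ← found
... | nothing with P (suc b) in holds
...   | true with () ← found
...   | false with m≤n⇒m<n∨m≡n k≤b
...     | inj₁ (s≤s k≤b′) = search-nothing P b found′ k≥1 k≤b′ t
...     | inj₂ refl       = subst T holds t

search-≡ᵇ-just : ∀ {N} (f : ℕ → ℕ) b {k} → search (λ k → N ≡ᵇ f k) b ≡ just k → 1 ≤ k × N ≡ f k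
search-≡ᵇ-just {N} f b {k} found with k≥1 , _ , t ← search-just _ b found = k≥1 , ≡ᵇ⇒≡ N (f k) t

search-≡ᵇ-nothing : ∀ {N} (f : ℕ → ℕ) b {k} → search (λ k → N ≡ᵇ f k) b ≡ nothing → 1 ≤ k → k ≤ b → N ≢ f k
search-≡ᵇ-nothing {N} f b {k} absent k≥1 k≤b e = search-nothing _ b absent k≥1 k≤b (≡⇒≡ᵇ N (f k) e)

cofactor : ℕ → ℤ → ℤ
cofactor h a = + h ℤ.+ + 1 ℤ.+ + 2 ℤ.* a

record IsRep (n h : ℕ) (a : ℤ) : Set where
  constructor isRep
  field
    positive : 1 ≤ h
    equation : + (2 * n) ≡ + h ℤ.* cofactor h a

isRep? : ∀ n → Decidable (uncurry (IsRep n))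
isRep? n (h , a) = map′ (uncurry isRep) (λ (isRep h≥1 e) → h≥1 , e)
  ((1 ℕ.≤? h) ×-dec (+ (2 * n) ℤ.≟ + h ℤ.* cofactor h a))

pos-suc-2* : ∀ m → + suc (2 * m) ≡ + 1 ℤ.+ + 2 ℤ.* + m
pos-suc-2* m = cong (ℤ._+_ (+ 1)) (ℤP.pos-* 2 m)

cofactor-+ : ∀ h m → + h ℤ.* cofactor h (+ m) ≡ + oblong (suc (2 * m)) h
cofactor-+ h m = begin
  + h ℤ.* cofactor h (+ m)          ≡⟨ cong (λ t → + h ℤ.* (+ (h + 1) ℤ.+ t)) (ℤP.pos-* 2 m) ⟨
  + h ℤ.* + (h + 1 + 2 * m)         ≡⟨ cong (λ t → + h ℤ.* + t) (+-suc-shift h m) ⟩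
  + h ℤ.* + (h + suc (2 * m))       ≡⟨ ℤP.pos-* h _ ⟨
  + oblong (suc (2 * m)) h          ∎
  where
  open ≡-Reasoning
  +-suc-shift : ∀ h m → h + 1 + 2 * m ≡ h + suc (2 * m)
  +-suc-shift = solve-∀

cofactor-neg : ∀ h m → cofactor h -[1+ m ] ℤ.+ + suc (2 * m) ≡ + h
cofactor-neg h m = trans (cong (ℤ._+_ (cofactor h -[1+ m ])) (pos-suc-2* m)) (identity (+ h) (+ m))
  where
  identity : ∀ h m → (h ℤ.+ + 1 ℤ.+ + 2 ℤ.* ℤ.- (+ 1 ℤ.+ m)) ℤ.+ (+ 1 ℤ.+ + 2 ℤ.* m) ≡ h
  identity = ℤSolver.solve-∀

cofactor-neg-shifted : ∀ k m → cofactor (k + suc (2 * m)) -[1+ m ] ≡ + k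
cofactor-neg-shifted k m = begin
  cofactor (k + suc (2 * m)) -[1+ m ]                      ≡⟨ cong (λ t → t ℤ.+ + 1 ℤ.+ + 2 ℤ.* -[1+ m ]) pos-shift ⟩
  (+ k ℤ.+ (+ 1 ℤ.+ + 2 ℤ.* + m)) ℤ.+ + 1 ℤ.+ + 2 ℤ.* -[1+ m ] ≡⟨ identity (+ k) (+ m) ⟩
  + k                                                       ∎
  where
  open ≡-Reasoning
  pos-shift : + (k + suc (2 * m)) ≡ + k ℤ.+ (+ 1 ℤ.+ + 2 ℤ.* + m)
  pos-shift = trans (ℤP.pos-+ k _) (cong (ℤ._+_ (+ k)) (pos-suc-2* m))
  identity : ∀ k m → (k ℤ.+ (+ 1 ℤ.+ + 2 ℤ.* m)) ℤ.+ + 1 ℤ.+ + 2 ℤ.* ℤ.- (+ 1 ℤ.+ m) ≡ k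
  identity = ℤSolver.solve-∀

isRep-+⇔ : ∀ {n h m} → IsRep n h (+ m) ⇔ (1 ≤ h × 2 * n ≡ oblong (suc (2 * m)) h)
isRep-+⇔ {n} {h} {m} = mk⇔
  (λ (isRep h≥1 e) → h≥1 , ℤP.+-injective (trans e (cofactor-+ h m)))
  (λ (h≥1 , e) → isRep h≥1 (trans (cong +_ e) (sym (cofactor-+ h m))))

isRep-neg⇒ : ∀ {n h m} → 1 ≤ n → IsRep n h -[1+ m ] →
             ∃[ k ] 1 ≤ k × h ≡ k + suc (2 * m) × 2 * n ≡ oblong (suc (2 * m)) k
isRep-neg⇒ {suc n} {suc h} {m} _ (isRep h≥1 e) with cofactor (suc h) -[1+ m ] in c≡
... | + zero with () ← trans e (ℤP.*-zeroʳ (+ suc h))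
... | -[1+ _ ] with () ← e
... | + suc k = suc k , s≤s z≤n , h≡ , (begin
  2 * suc n                    ≡⟨ ℤP.+-injective (trans e (sym (ℤP.pos-* (suc h) (suc k)))) ⟩
  suc h * suc k                ≡⟨ *-comm (suc h) (suc k) ⟩
  suc k * suc h                ≡⟨ cong (suc k *_) h≡ ⟩
  oblong (suc (2 * m)) (suc k) ∎)
  where
  open ≡-Reasoning
  h≡ : suc h ≡ suc k + suc (2 * m)
  h≡ = ℤP.+-injective (trans (sym (cofactor-neg (suc h) m)) (cong (ℤ._+ + suc (2 * m)) c≡))

isRep-neg⇐ : ∀ {n k m} → 1 ≤ k → 2 * n ≡ oblong (suc (2 * m)) k → IsRep n (k + suc (2 * m)) -[1+ m ]
isRep-neg⇐ {n} {k} {m} k≥1 e = isRep (≤-trans k≥1 (m≤m+n k _)) (begin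
  + (2 * n)                           ≡⟨ cong +_ (trans e (*-comm k h)) ⟩
  + (h * k)                           ≡⟨ ℤP.pos-* h k ⟩
  + h ℤ.* + k                         ≡⟨ cong (ℤ._*_ (+ h)) (cofactor-neg-shifted k m) ⟨
  + h ℤ.* cofactor h -[1+ m ]         ∎)
  where
  open ≡-Reasoning
  h = k + suc (2 * m)

isRep-bounded : ∀ {n h a} → 1 ≤ n → IsRep n h a → h ≤ 2 * n × ∣ a ∣ ≤ 2 * n
isRep-bounded {n} {h} {+ m} _ r with h≥1 , e ← Equivalence.to isRep-+⇔ r =
  ≤-trans (m≤m+n h _) bound , ≤-trans (m≤n*m m 2) (≤-trans (n≤1+n _) (≤-trans (m≤n+m _ h) bound))
  where
  bound : h + suc (2 * m) ≤ 2 * n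
  bound = ≤-trans (oblong-≥ _ h≥1) (≤-reflexive (sym e))
isRep-bounded {n} {h} { -[1+ m ]} n≥1 r with k , k≥1 , refl , e ← isRep-neg⇒ n≥1 r =
  h≤ , ≤-trans (s≤s (m≤n*m m 2)) (≤-trans (m≤n+m _ k) h≤)
  where
  h≤ : k + suc (2 * m) ≤ 2 * n
  h≤ = ≤-trans (oblong-≥ _ k≥1) (≤-reflexive (sym e))

isRep-+-injective : ∀ {n h h′ m} → IsRep n h (+ m) → IsRep n h′ (+ m) → h ≡ h′
isRep-+-injective r r′ =
  oblong-injective _ (trans (sym (proj₂ (Equivalence.to isRep-+⇔ r))) (proj₂ (Equivalence.to isRep-+⇔ r′)))

isRep-neg-injective : ∀ {n h h′ m} → 1 ≤ n → IsRep n h -[1+ m ] → IsRep n h′ -[1+ m ] → h ≡ h′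
isRep-neg-injective {m = m} n≥1 r r′
  with k , _ , refl , e ← isRep-neg⇒ n≥1 r | k′ , _ , refl , e′ ← isRep-neg⇒ n≥1 r′ =
  cong (_+ suc (2 * m)) (oblong-injective (suc (2 * m)) {k} {k′} (trans (sym e) e′))

-- a = m + 1 and a = -(m + 1) lead to 2n = oblong (2m + 3) h and 2n = oblong (2m + 1) k.
isRep-+-neg-exclusive : ∀ {n h h′ m} → 1 ≤ n → IsRep n h (+ suc m) → ¬ IsRep n h′ -[1+ m ]
isRep-+-neg-exclusive {n} {suc h} {h′} {m} n≥1 r r′
  with _ , e ← Equivalence.to isRep-+⇔ r | k , _ , _ , e′ ← isRep-neg⇒ n≥1 r′ =
  oblong-+2-≢ (suc (2 * m)) h k
    (trans (cong (λ c → oblong (suc c) (suc h)) (sym (*-suc 2 m))) (trans (sym e) e′))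

isRep-unique : ∀ {n h h′ a a′} → 1 ≤ n → IsRep n h a → IsRep n h′ a′ → ∣ a ∣ ≡ ∣ a′ ∣ → h ≡ h′ × a ≡ a′
isRep-unique {a = + m} {+ m} _ r r′ refl = isRep-+-injective r r′ , refl
isRep-unique {a = -[1+ m ]} { -[1+ m ]} n≥1 r r′ refl = isRep-neg-injective n≥1 r r′ , refl
isRep-unique {a = + _} { -[1+ m ]} n≥1 r r′ refl = ⊥-elim (isRep-+-neg-exclusive n≥1 r r′)
isRep-unique {a = -[1+ m ]} {+ _} n≥1 r r′ refl = ⊥-elim (isRep-+-neg-exclusive n≥1 r′ r)

intsBelow : ℕ → List ℤ
intsBelow M = map +_ (upTo M) ++ map -[1+_] (upTo M)

∈-intsBelow : ∀ {M} a → ∣ a ∣ < M → a ∈ intsBelow M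
∈-intsBelow (+ j)    j<M  = ∈-++⁺ˡ (∈-map⁺ +_ (∈-upTo⁺ j<M))
∈-intsBelow -[1+ j ] 1+j<M = ∈-++⁺ʳ _ (∈-map⁺ -[1+_] (∈-upTo⁺ (<⇒≤ 1+j<M)))

intsBelow-unique : ∀ M → Unique (intsBelow M)
intsBelow-unique M = ++⁺ (map⁺ ℤP.+-injective (upTo⁺ M)) (map⁺ ℤP.-[1+-injective (upTo⁺ M)) disjoint
  where
  disjoint : Disjoint (map +_ (upTo M)) (map -[1+_] (upTo M))
  disjoint (p , q) with _ , _ , refl ← ∈-map⁻ +_ p | _ , _ , () ← ∈-map⁻ -[1+_] q

candidates : ℕ → List (ℕ × ℤ)
candidates n = cartesianProduct (upTo (suc (2 * n))) (intsBelow (suc (2 * n)))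

reps : ℕ → List (ℕ × ℤ)
reps n = filter (isRep? n) (candidates n)

reps-unique : ∀ n → Unique (reps n)
reps-unique n = filter⁺ (isRep? n) (cartesianProduct⁺ (upTo⁺ (suc (2 * n))) (intsBelow-unique (suc (2 * n))))

∈-reps⁻ : ∀ {n h a} → (h , a) ∈ reps n → IsRep n h a
∈-reps⁻ {n} p = proj₂ (∈-filter⁻ (isRep? n) {xs = candidates n} p)

∈-reps⁺ : ∀ {n h a} → 1 ≤ n → IsRep n h a → (h , a) ∈ reps n
∈-reps⁺ {n} {h} {a} n≥1 r with h≤ , a≤ ← isRep-bounded n≥1 r =
  ∈-filter⁺ (isRep? n) (∈-cartesianProduct⁺ (∈-upTo⁺ (s≤s h≤)) (∈-intsBelow a (s≤s a≤))) r

∈-reps⇔ : ∀ {n h a} → 1 ≤ n → (h , a) ∈ reps n ⇔ IsRep n h a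
∈-reps⇔ {n} n≥1 = mk⇔ (∈-reps⁻ {n}) (∈-reps⁺ n≥1)

weight : List (ℕ × ℤ) → ℤ → ℤ
weight []            j = + 0
weight ((h , a) ∷ L) j = sgn h ℤ.* [ a ≟ j ] ℤ.+ weight L j

[≟]-refl : ∀ a → [ a ≟ a ] ≡ + 1
[≟]-refl a with a ℤ.≟ a
... | yes _   = refl
... | no a≢a = ⊥-elim (a≢a refl)

[≟]-≢ : ∀ {a j} → a ≢ j → [ a ≟ j ] ≡ + 0
[≟]-≢ {a} {j} a≢j with a ℤ.≟ j
... | yes a≡j = ⊥-elim (a≢j a≡j)
... | no _    = refl

[-≟]≡[≟-] : ∀ a j → [ ℤ.- a ≟ j ] ≡ [ a ≟ ℤ.- j ]
[-≟]≡[≟-] a j = cong (λ b → if b then + 1 else + 0)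
  (trans (isYes≗does (ℤ.- a ℤ.≟ j))
  (trans (does-⇔ neg-swap (ℤ.- a ℤ.≟ j) (a ℤ.≟ ℤ.- j)) (sym (isYes≗does (a ℤ.≟ ℤ.- j)))))
  where
  neg-swap : ℤ.- a ≡ j ⇔ a ≡ ℤ.- j
  neg-swap = mk⇔ (λ e → trans (sym (ℤP.neg-involutive a)) (cong ℤ.-_ e))
                 (λ e → trans (cong ℤ.-_ e) (ℤP.neg-involutive j))

sumCoeff-weight : ∀ L j → sumCoeff L j ≡ weight L j ℤ.+ weight L (ℤ.- j)
sumCoeff-weight []            j = refl
sumCoeff-weight ((h , a) ∷ L) j = begin
  sgn h ℤ.* ([ a ≟ j ] ℤ.+ [ ℤ.- a ≟ j ]) ℤ.+ sumCoeff L j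
    ≡⟨ cong₂ (λ x y → sgn h ℤ.* ([ a ≟ j ] ℤ.+ x) ℤ.+ y) ([-≟]≡[≟-] a j) (sumCoeff-weight L j) ⟩
  sgn h ℤ.* ([ a ≟ j ] ℤ.+ [ a ≟ ℤ.- j ]) ℤ.+ (weight L j ℤ.+ weight L (ℤ.- j))
    ≡⟨ regroup (sgn h) [ a ≟ j ] [ a ≟ ℤ.- j ] (weight L j) (weight L (ℤ.- j)) ⟩
  (sgn h ℤ.* [ a ≟ j ] ℤ.+ weight L j) ℤ.+ (sgn h ℤ.* [ a ≟ ℤ.- j ] ℤ.+ weight L (ℤ.- j)) ∎
  where
  open ≡-Reasoning
  regroup : ∀ s x y u v → s ℤ.* (x ℤ.+ y) ℤ.+ (u ℤ.+ v) ≡ (s ℤ.* x ℤ.+ u) ℤ.+ (s ℤ.* y ℤ.+ v)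
  regroup = ℤSolver.solve-∀

weight-∅ : ∀ {L j} → (∀ {h a} → (h , a) ∈ L → a ≢ j) → weight L j ≡ + 0
weight-∅ {[]}          _    = refl
weight-∅ {(h , a) ∷ L} a≢j = cong₂ ℤ._+_
  (trans (cong (sgn h ℤ.*_) ([≟]-≢ (a≢j (here refl)))) (ℤP.*-zeroʳ (sgn h)))
  (weight-∅ (a≢j ∘′ there))

weight-single : ∀ {L h j} → Unique L → (h , j) ∈ L → (∀ {h′} → (h′ , j) ∈ L → h′ ≡ h) → weight L j ≡ sgn h
weight-single {(h , j) ∷ L} (fresh ∷ _) (here refl) only = begin
  sgn h ℤ.* [ j ≟ j ] ℤ.+ weight L j ≡⟨ cong₂ (λ x y → sgn h ℤ.* x ℤ.+ y) ([≟]-refl j) (weight-∅ not-j) ⟩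
  sgn h ℤ.* + 1 ℤ.+ + 0              ≡⟨ trans (ℤP.+-identityʳ _) (ℤP.*-identityʳ (sgn h)) ⟩
  sgn h                              ∎
  where
  open ≡-Reasoning
  not-j : ∀ {h′ a} → (h′ , a) ∈ L → a ≢ j
  not-j p refl with refl ← only (there p) = All.lookup fresh p refl
weight-single {(h₀ , a) ∷ L} {h} {j} (fresh ∷ unique) (there p) only = begin
  sgn h₀ ℤ.* [ a ≟ j ] ℤ.+ weight L j
    ≡⟨ cong₂ (λ x y → sgn h₀ ℤ.* x ℤ.+ y) ([≟]-≢ a≢j) (weight-single unique p (only ∘′ there)) ⟩
  sgn h₀ ℤ.* + 0 ℤ.+ sgn h            ≡⟨ trans (cong (ℤ._+ sgn h) (ℤP.*-zeroʳ (sgn h₀))) (ℤP.+-identityˡ (sgn h)) ⟩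
  sgn h                               ∎
  where
  open ≡-Reasoning
  a≢j : a ≢ j
  a≢j refl with refl ← only (here refl) = All.lookup fresh p refl

weight-reps : ∀ {n h a} → 1 ≤ n → IsRep n h a → weight (reps n) a ≡ sgn h
weight-reps {n} {h} {a} n≥1 r =
  weight-single (reps-unique n) (∈-reps⁺ n≥1 r) (λ p → proj₁ (isRep-unique {a = a} {a} n≥1 (∈-reps⁻ {n} p) r refl))

weight-reps-∅ : ∀ {n a} → (∀ h → ¬ IsRep n h a) → weight (reps n) a ≡ + 0
weight-reps-∅ {n} {a} none = weight-∅ {reps n} {a} (λ {h} p a≡ → none h (subst (IsRep n h) a≡ (∈-reps⁻ {n} p)))

found-+-rep : ∀ {n m k} (f : ℕ → ℕ) → (∀ k → f k ≡ oblong (suc (2 * m)) k) →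
              search (λ k → 2 * n ≡ᵇ f k) (2 * n) ≡ just k → IsRep n k (+ m)
found-+-rep {n} {k = k} f f≡ found with k≥1 , e ← search-≡ᵇ-just f (2 * n) found =
  Equivalence.from isRep-+⇔ (k≥1 , trans e (f≡ k))

found-neg-rep : ∀ {n m k} (f : ℕ → ℕ) → (∀ k → f k ≡ oblong (suc (2 * m)) k) →
                search (λ k → 2 * n ≡ᵇ f k) (2 * n) ≡ just k → IsRep n (k + suc (2 * m)) -[1+ m ]
found-neg-rep {n} {k = k} f f≡ found with k≥1 , e ← search-≡ᵇ-just f (2 * n) found =
  isRep-neg⇐ k≥1 (trans e (f≡ k))

no-+-rep : ∀ {n m} (f : ℕ → ℕ) → (∀ k → f k ≡ oblong (suc (2 * m)) k) →
           search (λ k → 2 * n ≡ᵇ f k) (2 * n) ≡ nothing → 1 ≤ n → ∀ h → ¬ IsRep n h (+ m)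
no-+-rep {n} f f≡ absent n≥1 h r with h≥1 , e ← Equivalence.to isRep-+⇔ r =
  search-≡ᵇ-nothing f (2 * n) absent h≥1 (proj₁ (isRep-bounded n≥1 r)) (trans e (sym (f≡ h)))

no-neg-rep : ∀ {n m} (f : ℕ → ℕ) → (∀ k → f k ≡ oblong (suc (2 * m)) k) →
             search (λ k → 2 * n ≡ᵇ f k) (2 * n) ≡ nothing → 1 ≤ n → ∀ h → ¬ IsRep n h -[1+ m ]
no-neg-rep {n} f f≡ absent n≥1 h r with k , k≥1 , refl , e ← isRep-neg⇒ n≥1 r =
  search-≡ᵇ-nothing f (2 * n) absent k≥1 (≤-trans (m≤m+n k _) (proj₁ (isRep-bounded n≥1 r))) (trans e (sym (f≡ k)))

pos-test neg-test : ℕ → ℕ → ℕ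
pos-test i k = k * (k + 2 * i + 1)
neg-test i k = k * (k + 2 * i ∸ 1)

pos-test≡oblong : ∀ i k → pos-test i k ≡ oblong (suc (2 * i)) k
pos-test≡oblong i k = expand i k
  where
  expand : ∀ i k → k * (k + 2 * i + 1) ≡ k * (k + suc (2 * i))
  expand = solve-∀

neg-test≡oblong : ∀ m k → neg-test (suc m) k ≡ oblong (suc (2 * m)) k
neg-test≡oblong m k = cong (λ t → k * (t ∸ 1)) (shift k m)
  where
  shift : ∀ k m → k + 2 * suc m ≡ suc (k + suc (2 * m))
  shift = solve-∀

sgn-+-2* : ∀ k m → sgn (k + 2 * m) ≡ sgn k
sgn-+-2* k zero    = cong sgn (+-identityʳ k)
sgn-+-2* k (suc m) = begin
  sgn (k + 2 * suc m)         ≡⟨ cong sgn (shift k m) ⟩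
  sgn (suc (suc (k + 2 * m))) ≡⟨ ℤP.neg-involutive _ ⟩
  sgn (k + 2 * m)             ≡⟨ sgn-+-2* k m ⟩
  sgn k                       ∎
  where
  open ≡-Reasoning
  shift : ∀ k m → k + 2 * suc m ≡ suc (suc (k + 2 * m))
  shift = solve-∀

c₀-weight : ∀ {n} → 1 ≤ n → c₀ n ≡ weight (reps n) (+ 0) ℤ.+ weight (reps n) (+ 0)
c₀-weight {n} n≥1 with search (λ r → 2 * n ≡ᵇ r * (r + 1)) (2 * n) in found
... | just r = trans (double (sgn r)) (sym (cong₂ ℤ._+_ w w))
  where
  w : weight (reps n) (+ 0) ≡ sgn r
  w = weight-reps n≥1 (found-+-rep (λ r → r * (r + 1)) (λ _ → refl) found)
  double : ∀ s → + 2 ℤ.* s ≡ s ℤ.+ s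
  double = ℤSolver.solve-∀
... | nothing = sym (cong₂ ℤ._+_ w w)
  where
  w : weight (reps n) (+ 0) ≡ + 0
  w = weight-reps-∅ (no-+-rep (λ r → r * (r + 1)) (λ _ → refl) found n≥1)

cᵢ-weight : ∀ {n m} → 1 ≤ n → cᵢ n (suc m) ≡ weight (reps n) (+ suc m) ℤ.+ weight (reps n) -[1+ m ]
cᵢ-weight {n} {m} n≥1 with search (λ k → 2 * n ≡ᵇ k * (k + 2 * suc m + 1)) (2 * n) in found₊
... | just k = sym (trans
  (cong₂ ℤ._+_ (weight-reps n≥1 r) (weight-reps-∅ λ h → isRep-+-neg-exclusive n≥1 r))
  (ℤP.+-identityʳ (sgn k)))
  where
  r : IsRep n k (+ suc m)
  r = found-+-rep (pos-test (suc m)) (pos-test≡oblong (suc m)) found₊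
... | nothing with search (λ k → 2 * n ≡ᵇ k * (k + 2 * suc m ∸ 1)) (2 * n) in found₋
...   | just (suc k) = sym (trans
  (cong₂ ℤ._+_ (weight-reps-∅ no-+) (trans (weight-reps n≥1 r) parity))
  (ℤP.+-identityˡ (sgn k)))
  where
  no-+ : ∀ h → ¬ IsRep n h (+ suc m)
  no-+ = no-+-rep (pos-test (suc m)) (pos-test≡oblong (suc m)) found₊ n≥1
  r : IsRep n (suc k + suc (2 * m)) -[1+ m ]
  r = found-neg-rep (neg-test (suc m)) (neg-test≡oblong m) found₋
  parity : sgn (suc k + suc (2 * m)) ≡ sgn k
  parity = trans (cong sgn (shift k m)) (sgn-+-2* k (suc m))
    where
    shift : ∀ k m → suc k + suc (2 * m) ≡ k + 2 * suc m
    shift = solve-∀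
...   | just zero with () ← proj₁ (search-just _ (2 * n) found₋)
...   | nothing = sym (cong₂ ℤ._+_
  (weight-reps-∅ (no-+-rep (pos-test (suc m)) (pos-test≡oblong (suc m)) found₊ n≥1))
  (weight-reps-∅ (no-neg-rep (neg-test (suc m)) (neg-test≡oblong m) found₋ n≥1)))

coeff-weight : ∀ {n} → 1 ≤ n → ∀ j → CnOverQnCoeff n j ≡ weight (reps n) j ℤ.+ weight (reps n) (ℤ.- j)
coeff-weight n≥1 (+ zero)  = c₀-weight n≥1
coeff-weight n≥1 (+ suc m) = cᵢ-weight n≥1
coeff-weight {n} n≥1 -[1+ m ] = trans (cᵢ-weight n≥1) (ℤP.+-comm (weight (reps n) (+ suc m)) _)

lemma5p2 : (n : ℕ) → 1 ≤ n →
    Σ (List (ℕ × ℤ)) (λ L →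
        Unique L
      × (∀ (h : ℕ) (a : ℤ) → ((h , a) ∈ L ⇔ (1 ≤ h × + (2 ℕ.* n) ≡ + h ℤ.* (+ h ℤ.+ + 1 ℤ.+ + 2 ℤ.* a))))
      × (∀ (j : ℤ) → CnOverQnCoeff n j ≡ sumCoeff L j))
    × (∀ (h h′ : ℕ) (a a′ : ℤ) → 1 ≤ h → 1 ≤ h′
        → + (2 ℕ.* n) ≡ + h ℤ.* (+ h ℤ.+ + 1 ℤ.+ + 2 ℤ.* a)
        → + (2 ℕ.* n) ≡ + h′ ℤ.* (+ h′ ℤ.+ + 1 ℤ.+ + 2 ℤ.* a′)
        → ∣ a ∣ ≡ ∣ a′ ∣ → h ≡ h′ × a ≡ a′)
lemma5p2 n n≥1 =
  ( reps n
  , reps-unique n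
  , (λ h a → isRep⇔× ⇔-∘ ∈-reps⇔ n≥1)
  , (λ j → trans (coeff-weight n≥1 j) (sym (sumCoeff-weight (reps n) j))))
  , λ h h′ a a′ h≥1 h′≥1 e e′ → isRep-unique n≥1 (isRep h≥1 e) (isRep h′≥1 e′)
  where
  isRep⇔× : ∀ {h a} → IsRep n h a ⇔ (1 ≤ h × + (2 * n) ≡ + h ℤ.* cofactor h a)
  isRep⇔× = mk⇔ (λ (isRep h≥1 e) → h≥1 , e) (uncurry isRep)
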